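{- Let $G_1$ and $G_2$ be graphs with disjoint vertex sets. Then $\mathrm{thin}_{prec}(G_1\cup G_2)=\mathrm{thin}_{prec}(G_1)+\mathrm{thin}_{prec}(G_2)-1$.
   Context: $G_1\cup G_2$ is the graph with vertex set $V(G_1)\cup V(G_2)$ and edge set $E(G_1)\cup E(G_2)$. An ordering $<$ of $V(G)$ is consistent with a partition $\mathcal{V}$ if for every $p<q<r$ with $p,q$ in the same class and $pr\in E(G)$, also $qr\in E(G)$. The precedence thinness $\mathrm{thin}_{prec}(G)$ is the minimum $k$ such that there exist a partition of $V(G)$ into $k$ classes and an ordering consistent with it in which the vertices of each class are consecutive. -}

module Defs where

open import Level using (0ℓ)
open import Data.Nat using (ℕ; _+_; _<_; _≤_)
open import Data.Fin using (Fin; splitAt)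
open import Data.Sum using (_⊎_; inj₁; inj₂)
open import Data.Product using (Σ; _×_; _,_)
open import Data.Empty using (⊥)
open import Relation.Nullary using (¬_)
open import Relation.Binary.PropositionalEquality using (_≡_)
open import Function.Definitions using (Injective; Surjective)

record Graph : Set₁ where
  field
    n     : ℕ
    E     : Fin n → Fin n → Set
    sym   : ∀ {u v} → E u v → E v u
    irrefl : ∀ {u} → ¬ E u u
open Graph public

-- Union of two graphs with disjoint vertex sets: vertices of G₁ are
-- the first n G₁ elements of Fin (n G₁ + n G₂), those of G₂ the rest.
∪E : (G₁ G₂ : Graph) → Fin (n G₁ + n G₂) → Fin (n G₁ + n G₂) → Set
∪E G₁ G₂ u v with splitAt (n G₁) u | splitAt (n G₁) v
... | inj₁ a | inj₁ b = E G₁ a b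
... | inj₂ a | inj₂ b = E G₂ a b
... | inj₁ _ | inj₂ _ = ⊥
... | inj₂ _ | inj₁ _ = ⊥

∪sym : (G₁ G₂ : Graph) → ∀ {u v} → ∪E G₁ G₂ u v → ∪E G₁ G₂ v u
∪sym G₁ G₂ {u} {v} e with splitAt (n G₁) u | splitAt (n G₁) v
... | inj₁ a | inj₁ b = sym G₁ e
... | inj₂ a | inj₂ b = sym G₂ e

∪irrefl : (G₁ G₂ : Graph) → ∀ {u} → ¬ ∪E G₁ G₂ u u
∪irrefl G₁ G₂ {u} e with splitAt (n G₁) u
... | inj₁ a = irrefl G₁ e
... | inj₂ a = irrefl G₂ e

_∪_ : Graph → Graph → Graph
G₁ ∪ G₂ = record
  { n = n G₁ + n G₂ ; E = ∪E G₁ G₂ ; sym = ∪sym G₁ G₂ ; irrefl = ∪irrefl G₁ G₂ }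

-- A partition of V(G) into k (nonempty) classes: a surjective class map.
-- A linear ordering of V(G): an injective position map into ℕ
-- (p < q iff pos p < pos q).
Consistent : (G : Graph) {k : ℕ} → (Fin (n G) → Fin k) → (Fin (n G) → ℕ) → Set
Consistent G cls pos = ∀ p q r → pos p < pos q → pos q < pos r →
  cls p ≡ cls q → E G p r → E G q r

Consecutive : (G : Graph) {k : ℕ} → (Fin (n G) → Fin k) → (Fin (n G) → ℕ) → Set
Consecutive G cls pos = ∀ p q r → pos p < pos q → pos q < pos r →
  cls p ≡ cls r → cls q ≡ cls p

PrecPartition : Graph → ℕ → Set
PrecPartition G k =
  Σ (Fin (n G) → Fin k) λ cls → Σ (Fin (n G) → ℕ) λ pos →
    Surjective _≡_ _≡_ cls × Injective _≡_ _≡_ pos ×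
    Consistent G cls pos × Consecutive G cls pos

ThinPrec : Graph → ℕ → Set
ThinPrec G k = PrecPartition G k × (∀ j → PrecPartition G j → k ≤ j)

-- Upper bound: place G₁ before G₂ and relabel so that the class of the last
-- vertex of G₁ is its top class and the class of the first vertex of G₂ is its
-- bottom class.  By consecutiveness these classes are a final, resp. initial,
-- segment of their orders, so identifying them keeps the ordering consistent and
-- the classes consecutive, with k₁ + k₂ - 1 classes.
-- Lower bound: restrict a partition of G₁ ∪ G₂ with k classes to G₁.  A vertex of
-- G₁ is bad if it is not the last vertex of G₁ and a vertex of G₂ of its class
-- follows it; move every vertex to the class of the first good vertex at or after
-- it.  As no edge joins G₁ and G₂, this stays consistent.  Do the same for G₂.
-- In a class now used by both sides, take good vertices x ∈ G₁ and y ∈ G₂: the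
-- earlier one is the last vertex of its side.  So every shared class is the class
-- of the last vertex of G₁ or of G₂, and if both kinds occurred we would get
-- last(G₁) < y ≤ last(G₂) < x′ ≤ last(G₁).  Hence at most one class is shared and
-- the two restrictions use at most k + 1 classes.

module Submission where

open import Defs hiding (sym)
open import Data.Nat using (ℕ; zero; suc; _+_; _∸_; _<_; _≤_; z≤n; s≤s)
open import Data.Nat.Properties
  using ( ≤-refl; ≤-reflexive; ≤-trans; <-trans; <-irrefl; <-asym; <⇒≤; <-≤-trans
        ; ≮⇒≥; ≤-antisym; <-cmp; m≤n⇒m<n∨m≡n; m≤n⇒m≤1+n; +-suc; +-comm; m≤m+n; +-cancelˡ-≡
        ; +-cancelˡ-<; +-monoʳ-≤; +-mono-≤; ∸-monoˡ-≤; n≤0⇒n≡0; +-identityʳ; +-cancelˡ-≤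
        ; _≤?_; _<?_; <⇒≱; ≤∧≢⇒<; module ≤-Reasoning)
open import Data.Fin using (Fin; zero; suc; toℕ; fromℕ; fromℕ<; inject≤; inject₁; _↑ˡ_; _↑ʳ_; splitAt)
open import Data.Fin.Properties
  using ( suc-injective; 0≢1+n; any?; _≟_; toℕ-injective; toℕ-fromℕ; toℕ-inject≤; toℕ-inject₁
        ; toℕ-↑ˡ; toℕ-↑ʳ; toℕ≤pred[n]; inject≤-injective; ↑ˡ-injective; ↑ʳ-injective
        ; splitAt-↑ˡ; splitAt-↑ʳ; splitAt⁻¹-↑ˡ; splitAt⁻¹-↑ʳ)
open import Data.Fin.Permutation using (Permutation; _⟨$⟩ʳ_; _⟨$⟩ˡ_; inverseˡ; inverseʳ; transpose)
open import Data.List using (allFin; filter; map)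
open import Data.List.Extrema.Nat
  using (argmin; argmax; argmin-all; f[argmin]≤f[xs]; f[xs]≤f[argmax]; max; xs≤max)
open import Data.List.Membership.Propositional.Properties using (∈-allFin; ∈-filter⁺)
open import Data.List.Relation.Unary.All using (lookup)
open import Data.List.Relation.Unary.All.Properties using (all-filter; map⁻)
open import Data.Sum using (_⊎_; inj₁; inj₂)
open import Data.Product using (Σ; ∃; ∃₂; _×_; _,_; proj₁; proj₂)
open import Data.Empty using (⊥; ⊥-elim)
open import Function using (_∘_; id; _⇔_; mk⇔; Equivalence)
open import Function.Definitions using (Injective; Surjective)
open import Level using (Level)
open import Relation.Nullary using (¬_; yes; no)
open import Relation.Nullary.Decidable using (_×-dec_; ¬?; dec-true)
open import Relation.Unary using (Pred; Decidable)
open import Relation.Unary.Properties using (_∩?_)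
open import Relation.Binary using (tri<; tri≈; tri>)
open import Relation.Binary.PropositionalEquality
  using (_≡_; _≢_; refl; sym; trans; cong; subst; subst₂; module ≡-Reasoning)

private variable
  ℓ ℓ′ : Level
  k m : ℕ

count : {P : Pred (Fin k) ℓ} → Decidable P → ℕ
count {k = zero} P? = 0
count {k = suc k} P? with P? zero
... | yes _ = suc (count (P? ∘ suc))
... | no _ = count (P? ∘ suc)

rank : {P : Pred (Fin k) ℓ} (P? : Decidable P) {c : Fin k} → P c → Fin (count P?)
rank {k = suc k} P? {c} pc with P? zero | c
... | yes _  | zero  = zero
... | yes _  | suc c = suc (rank (P? ∘ suc) pc)
... | no ¬p0 | zero  = ⊥-elim (¬p0 pc)
... | no _   | suc c = rank (P? ∘ suc) pc

rank-injective : {P : Pred (Fin k) ℓ} (P? : Decidable P) {c d : Fin k} (pc : P c) (pd : P d) →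
                 rank P? pc ≡ rank P? pd → c ≡ d
rank-injective {k = suc k} P? {c} {d} pc pd eq with P? zero | c | d
... | yes _  | zero  | zero  = refl
... | yes _  | suc c | suc d = cong suc (rank-injective (P? ∘ suc) pc pd (suc-injective eq))
... | no ¬p0 | zero  | _     = ⊥-elim (¬p0 pc)
... | no ¬p0 | suc _ | zero  = ⊥-elim (¬p0 pd)
... | no _   | suc c | suc d = cong suc (rank-injective (P? ∘ suc) pc pd eq)

rank-cong : {P : Pred (Fin k) ℓ} (P? : Decidable P) {c d : Fin k} (pc : P c) (pd : P d) →
            c ≡ d → rank P? pc ≡ rank P? pd
rank-cong {k = suc k} P? {c} pc pd refl with P? zero | c
... | yes _  | zero  = refl
... | yes _  | suc c = cong suc (rank-cong (P? ∘ suc) pc pd refl)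
... | no ¬p0 | zero  = ⊥-elim (¬p0 pc)
... | no _   | suc c = rank-cong (P? ∘ suc) pc pd refl

rank-surjective : {P : Pred (Fin k) ℓ} (P? : Decidable P) (i : Fin (count P?)) →
                  ∃ λ c → Σ (P c) λ pc → rank P? pc ≡ i
rank-surjective {k = suc k} P? i with P? zero | i
... | yes p0 | zero  = zero , p0 , refl
... | yes _  | suc i = let c , pc , eq = rank-surjective (P? ∘ suc) i in suc c , pc , cong suc eq
... | no _   | i     = let c , pc , eq = rank-surjective (P? ∘ suc) i in suc c , pc , eq

count≡0 : {P : Pred (Fin k) ℓ} (P? : Decidable P) → (∀ c → ¬ P c) → count P? ≡ 0
count≡0 {k = zero} P? none = refl
count≡0 {k = suc k} P? none with P? zero
... | yes p0 = ⊥-elim (none zero p0)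
... | no _   = count≡0 (P? ∘ suc) (none ∘ suc)

count≤1 : {P : Pred (Fin k) ℓ} (P? : Decidable P) → (∀ {c d} → P c → P d → c ≡ d) → count P? ≤ 1
count≤1 {k = zero} P? unique = z≤n
count≤1 {k = suc k} P? unique with P? zero
... | yes p0 = s≤s (≤-reflexive (count≡0 (P? ∘ suc) λ c pc → 0≢1+n (unique p0 pc)))
... | no _   = count≤1 (P? ∘ suc) (λ pc pd → suc-injective (unique pc pd))

count-inclusion-exclusion : {P : Pred (Fin k) ℓ} {Q : Pred (Fin k) ℓ′} (P? : Decidable P) (Q? : Decidable Q) →
          count P? + count Q? ≤ k + count (P? ∩? Q?)
count-inclusion-exclusion {k = zero} P? Q? = z≤n
count-inclusion-exclusion {k = suc k} P? Q? with P? zero | Q? zero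
... | yes _ | yes _ = s≤s (subst₂ _≤_ (sym (+-suc (count (P? ∘ suc)) (count (Q? ∘ suc))))
                                      (sym (+-suc k (count ((P? ∩? Q?) ∘ suc))))
                                      (s≤s (count-inclusion-exclusion (P? ∘ suc) (Q? ∘ suc))))
... | yes _ | no _  = s≤s (count-inclusion-exclusion (P? ∘ suc) (Q? ∘ suc))
... | no _  | yes _ = subst (_≤ suc k + count ((P? ∩? Q?) ∘ suc))
                            (sym (+-suc (count (P? ∘ suc)) (count (Q? ∘ suc))))
                            (s≤s (count-inclusion-exclusion (P? ∘ suc) (Q? ∘ suc)))
... | no _  | no _  = m≤n⇒m≤1+n (count-inclusion-exclusion (P? ∘ suc) (Q? ∘ suc))

Used : (Fin m → Fin k) → Pred (Fin k) _
Used L c = ∃ λ a → L a ≡ c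

used? : (L : Fin m → Fin k) → Decidable (Used L)
used? L c = any? λ a → L a ≟ c

maximum : (f : Fin m → ℕ) → Fin m → ∃ λ x → ∀ u → f u ≤ f x
maximum f v = argmax f v (allFin _) , λ u → lookup (f[xs]≤f[argmax] v (allFin _)) (∈-allFin u)

minimum : (f : Fin m → ℕ) → Fin m → ∃ λ x → ∀ u → f x ≤ f u
minimum f v = argmin f v (allFin _) , λ u → lookup (f[argmin]≤f[xs] v (allFin _)) (∈-allFin u)

least-satisfying : (f : Fin m → ℕ) {P : Pred (Fin m) ℓ} → Decidable P → ∀ {x} → P x →
                   ∃ λ u → P u × (∀ {v} → P v → f u ≤ f v)
least-satisfying f P? {x} px =
  argmin f x xs , argmin-all f px (all-filter P? (allFin _)) ,
  λ pv → lookup (f[argmin]≤f[xs] x xs) (∈-filter⁺ P? (∈-allFin _) pv)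
  where xs = filter P? (allFin _)

strict-upper-bound : (f : Fin m → ℕ) → ∃ λ M → ∀ u → f u < M
strict-upper-bound f =
  suc (max 0 (map f (allFin _))) , λ u → s≤s (lookup (map⁻ (xs≤max 0 (map f (allFin _)))) (∈-allFin u))

FinalClass : {V : Set} (cls : V → Fin k) (pos : V → ℕ) → Fin k → Set
FinalClass cls pos c = ∀ {p q} → pos p < pos q → cls p ≡ c → cls q ≡ c

InitialClass : {V : Set} (cls : V → Fin k) (pos : V → ℕ) → Fin k → Set
InitialClass cls pos c = ∀ {q r} → pos q < pos r → cls r ≡ c → cls q ≡ c

⟨$⟩ʳ-injective : ∀ {k′} (π : Permutation k k′) {i j} → π ⟨$⟩ʳ i ≡ π ⟨$⟩ʳ j → i ≡ j
⟨$⟩ʳ-injective π {i} {j} eq = trans (sym (inverseˡ π)) (trans (cong (π ⟨$⟩ˡ_) eq) (inverseˡ π))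

transpose-matchˡ : (i j : Fin k) → transpose i j ⟨$⟩ʳ i ≡ j
transpose-matchˡ i j rewrite dec-true (i ≟ i) refl = refl

module _ (G : Graph) where

  module Fields (pp : PrecPartition G k) where
    cls : Fin (n G) → Fin k
    cls = proj₁ pp
    pos : Fin (n G) → ℕ
    pos = proj₁ (proj₂ pp)
    cls-surjective : Surjective _≡_ _≡_ cls
    cls-surjective = proj₁ (proj₂ (proj₂ pp))
    pos-injective : Injective _≡_ _≡_ pos
    pos-injective = proj₁ (proj₂ (proj₂ (proj₂ pp)))
    consistent : Consistent G cls pos
    consistent = proj₁ (proj₂ (proj₂ (proj₂ (proj₂ pp))))
    consecutive : Consecutive G cls pos
    consecutive = proj₂ (proj₂ (proj₂ (proj₂ (proj₂ pp))))

  module _ {k′ : ℕ} {cls : Fin (n G) → Fin k} {cls′ : Fin (n G) → Fin k′} {pos : Fin (n G) → ℕ}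
           (reflect : ∀ {a b} → cls′ a ≡ cls′ b → cls a ≡ cls b) where

    consistent-resp : Consistent G cls pos → Consistent G cls′ pos
    consistent-resp cons p q r p<q q<r p~q = cons p q r p<q q<r (reflect p~q)

    consecutive-resp : (∀ {a b} → cls a ≡ cls b → cls′ a ≡ cls′ b) →
                       Consecutive G cls pos → Consecutive G cls′ pos
    consecutive-resp preserve consec p q r p<q q<r p~r = preserve (consec p q r p<q q<r (reflect p~r))

  compress : {L : Fin (n G) → Fin k} {pos : Fin (n G) → ℕ} → Injective _≡_ _≡_ pos →
             Consistent G L pos → Consecutive G L pos → PrecPartition G (count (used? L))
  compress {L = L} {pos = pos} pos-injective cons consec =
    cls , pos , surjective , pos-injective , consistent-resp reflect cons , consecutive-resp reflect preserve consec
    where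
      cls : Fin (n G) → Fin (count (used? L))
      cls a = rank (used? L) (a , refl)
      reflect : ∀ {a b} → cls a ≡ cls b → L a ≡ L b
      reflect = rank-injective (used? L) _ _
      preserve : ∀ {a b} → L a ≡ L b → cls a ≡ cls b
      preserve = rank-cong (used? L) _ _
      surjective : Surjective _≡_ _≡_ cls
      surjective i with rank-surjective (used? L) i
      ... | _ , (a , La≡c) , rank≡i = a , λ { refl → trans (rank-cong (used? L) _ _ La≡c) rank≡i }

  relabel : ∀ {k′} → Permutation k k′ → PrecPartition G k → PrecPartition G k′
  relabel π (cls , pos , surjective , pos-injective , cons , consec) =
    (π ⟨$⟩ʳ_) ∘ cls , pos , surjective′ , pos-injective ,
    consistent-resp (⟨$⟩ʳ-injective π) cons ,
    consecutive-resp (⟨$⟩ʳ-injective π) (cong (π ⟨$⟩ʳ_)) consec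
    where
      surjective′ : Surjective _≡_ _≡_ ((π ⟨$⟩ʳ_) ∘ cls)
      surjective′ y = let a , h = surjective (π ⟨$⟩ˡ y) in
        a , λ z≡a → trans (cong (π ⟨$⟩ʳ_) (h z≡a)) (inverseʳ π)

  HasFinalClass HasInitialClass : PrecPartition G k → Fin k → Set
  HasFinalClass pp = FinalClass (Fields.cls pp) (Fields.pos pp)
  HasInitialClass pp = InitialClass (Fields.cls pp) (Fields.pos pp)

  module _ (pp : PrecPartition G k) where
    open Fields pp

    last-class-final : ∀ {x} → (∀ u → pos u ≤ pos x) → HasFinalClass pp (cls x)
    last-class-final {x} last {p} {q} p<q p~x with m≤n⇒m<n∨m≡n (last q)
    ... | inj₁ q<x = trans (consecutive p q x p<q q<x p~x) p~x
    ... | inj₂ q≡x = cong cls (pos-injective q≡x)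

    first-class-initial : ∀ {x} → (∀ u → pos x ≤ pos u) → HasInitialClass pp (cls x)
    first-class-initial {x} first {q} {r} q<r r~x with m≤n⇒m<n∨m≡n (first q)
    ... | inj₁ x<q = consecutive x q r x<q q<r (sym r~x)
    ... | inj₂ x≡q = cong cls (pos-injective (sym x≡q))

  with-final-class : Fin (n G) → PrecPartition G k → (c : Fin k) →
                     Σ (PrecPartition G k) λ pp → HasFinalClass pp c
  with-final-class v pp c = relabel π pp , final
    where
      open Fields pp
      x = proj₁ (maximum pos v)
      π = transpose (cls x) c
      final : HasFinalClass (relabel π pp) c
      final p<q πp≡c = trans (cong (π ⟨$⟩ʳ_) (last-class-final pp (proj₂ (maximum pos v)) p<q
                               (⟨$⟩ʳ-injective π (trans πp≡c (sym (transpose-matchˡ (cls x) c))))))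
                             (transpose-matchˡ (cls x) c)

  with-initial-class : Fin (n G) → PrecPartition G k → (c : Fin k) →
                       Σ (PrecPartition G k) λ pp → HasInitialClass pp c
  with-initial-class v pp c = relabel π pp , initial
    where
      open Fields pp
      x = proj₁ (minimum pos v)
      π = transpose (cls x) c
      initial : HasInitialClass (relabel π pp) c
      initial q<r πr≡c = trans (cong (π ⟨$⟩ʳ_) (first-class-initial pp (proj₂ (minimum pos v)) q<r
                                 (⟨$⟩ʳ-injective π (trans πr≡c (sym (transpose-matchˡ (cls x) c))))))
                               (transpose-matchˡ (cls x) c)

-- Labels 0 … a of the first partition and a … a + b of the second, sharing a.
module _ {a b : ℕ} where

  glueˡ : Fin (suc a) → Fin (a + suc b)
  glueˡ i = inject≤ i (≤-trans (s≤s (m≤m+n a b)) (≤-reflexive (sym (+-suc a b))))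

  glueʳ : Fin (suc b) → Fin (a + suc b)
  glueʳ j = a ↑ʳ j

  glueˡ-injective : ∀ {i i′} → glueˡ i ≡ glueˡ i′ → i ≡ i′
  glueˡ-injective = inject≤-injective _ _ _ _

  glueʳ-injective : ∀ {j j′} → glueʳ j ≡ glueʳ j′ → j ≡ j′
  glueʳ-injective = ↑ʳ-injective a _ _

  glue-overlap : glueˡ (fromℕ a) ≡ glueʳ zero
  glue-overlap = toℕ-injective (begin
    toℕ (glueˡ (fromℕ a)) ≡⟨ toℕ-inject≤ (fromℕ a) _ ⟩
    toℕ (fromℕ a)         ≡⟨ toℕ-fromℕ a ⟩
    a                     ≡⟨ sym (+-identityʳ a) ⟩
    a + 0                 ≡⟨ sym (toℕ-↑ʳ a zero) ⟩
    toℕ (glueʳ zero)      ∎)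
    where open ≡-Reasoning

  glue-overlap-only : ∀ {i j} → glueˡ i ≡ glueʳ j → i ≡ fromℕ a × j ≡ zero
  glue-overlap-only {i} {j} eq = toℕ-injective (trans i≡a (sym (toℕ-fromℕ a))) , toℕ-injective j≡0
    where
      i≡a+j : toℕ i ≡ a + toℕ j
      i≡a+j = trans (sym (toℕ-inject≤ i _)) (trans (cong toℕ eq) (toℕ-↑ʳ a j))
      j≡0 : toℕ j ≡ 0
      j≡0 = n≤0⇒n≡0 (+-cancelˡ-≤ a (toℕ j) 0
              (subst₂ _≤_ i≡a+j (sym (+-identityʳ a)) (toℕ≤pred[n] i)))
      i≡a : toℕ i ≡ a
      i≡a = trans i≡a+j (trans (cong (a +_) j≡0) (+-identityʳ a))

  glue-cover : ∀ y → (∃ λ i → glueˡ i ≡ y) ⊎ (∃ λ j → glueʳ j ≡ y)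
  glue-cover y with splitAt a y in eq
  ... | inj₁ i = inj₁ (inject₁ i , toℕ-injective (begin
    toℕ (glueˡ (inject₁ i)) ≡⟨ toℕ-inject≤ (inject₁ i) _ ⟩
    toℕ (inject₁ i)         ≡⟨ toℕ-inject₁ i ⟩
    toℕ i                   ≡⟨ sym (toℕ-↑ˡ i (suc b)) ⟩
    toℕ (i ↑ˡ suc b)        ≡⟨ cong toℕ (splitAt⁻¹-↑ˡ eq) ⟩
    toℕ y                   ∎))
    where open ≡-Reasoning
  ... | inj₂ j = inj₂ (j , splitAt⁻¹-↑ʳ eq)

module Gluing {G₁ G₂ : Graph} {a b : ℕ}
  (pp₁ : PrecPartition G₁ (suc a)) (final : HasFinalClass G₁ pp₁ (fromℕ a))
  (pp₂ : PrecPartition G₂ (suc b)) (initial : HasInitialClass G₂ pp₂ zero) where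

  module P₁ = Fields G₁ pp₁
  module P₂ = Fields G₂ pp₂

  M : ℕ
  M = proj₁ (strict-upper-bound P₁.pos)

  pos₁<pos₂ : ∀ u v → P₁.pos u < M + P₂.pos v
  pos₁<pos₂ u v = <-≤-trans (proj₂ (strict-upper-bound P₁.pos) u) (m≤m+n M (P₂.pos v))

  cls : Fin (n G₁ + n G₂) → Fin (a + suc b)
  cls x with splitAt (n G₁) x
  ... | inj₁ u = glueˡ (P₁.cls u)
  ... | inj₂ v = glueʳ (P₂.cls v)

  pos : Fin (n G₁ + n G₂) → ℕ
  pos x with splitAt (n G₁) x
  ... | inj₁ u = P₁.pos u
  ... | inj₂ v = M + P₂.pos v

  cls-↑ˡ : ∀ u → cls (u ↑ˡ n G₂) ≡ glueˡ (P₁.cls u)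
  cls-↑ˡ u rewrite splitAt-↑ˡ (n G₁) u (n G₂) = refl

  cls-↑ʳ : ∀ v → cls (n G₁ ↑ʳ v) ≡ glueʳ (P₂.cls v)
  cls-↑ʳ v rewrite splitAt-↑ʳ (n G₁) (n G₂) v = refl

  cls-surjective : Surjective _≡_ _≡_ cls
  cls-surjective y with glue-cover y
  ... | inj₁ (i , refl) = let u , h = P₁.cls-surjective i in
    u ↑ˡ n G₂ , λ { refl → trans (cls-↑ˡ u) (cong glueˡ (h refl)) }
  ... | inj₂ (j , refl) = let v , h = P₂.cls-surjective j in
    n G₁ ↑ʳ v , λ { refl → trans (cls-↑ʳ v) (cong glueʳ (h refl)) }

  pos-injective : Injective _≡_ _≡_ pos
  pos-injective {x} {y} eq with splitAt (n G₁) x in ex | splitAt (n G₁) y in ey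
  ... | inj₁ u | inj₁ v = trans (sym (splitAt⁻¹-↑ˡ ex))
                            (trans (cong (_↑ˡ n G₂) (P₁.pos-injective eq)) (splitAt⁻¹-↑ˡ ey))
  ... | inj₂ u | inj₂ v = trans (sym (splitAt⁻¹-↑ʳ ex))
                            (trans (cong (n G₁ ↑ʳ_) (P₂.pos-injective (+-cancelˡ-≡ M _ _ eq)))
                                   (splitAt⁻¹-↑ʳ ey))
  ... | inj₁ u | inj₂ v = ⊥-elim (<-irrefl eq (pos₁<pos₂ u v))
  ... | inj₂ u | inj₁ v = ⊥-elim (<-irrefl (sym eq) (pos₁<pos₂ v u))

  consistent : Consistent (G₁ ∪ G₂) cls pos
  consistent p q r p<q q<r p~q e with splitAt (n G₁) p | splitAt (n G₁) q | splitAt (n G₁) r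
  ... | inj₁ u | inj₁ v | inj₁ w = P₁.consistent u v w p<q q<r (glueˡ-injective p~q) e
  ... | inj₂ u | inj₂ v | inj₂ w =
    P₂.consistent u v w (+-cancelˡ-< M _ _ p<q) (+-cancelˡ-< M _ _ q<r) (glueʳ-injective p~q) e
  ... | inj₂ u | inj₁ v | _      = ⊥-elim (<-asym p<q (pos₁<pos₂ v u))
  ... | inj₁ _ | inj₂ v | inj₁ w = ⊥-elim (<-asym q<r (pos₁<pos₂ w v))
  ... | inj₁ _ | _      | inj₂ _ = ⊥-elim e
  ... | inj₂ _ | inj₂ _ | inj₁ _ = ⊥-elim e

  consecutive : Consecutive (G₁ ∪ G₂) cls pos
  consecutive p q r p<q q<r p~r with splitAt (n G₁) p | splitAt (n G₁) q | splitAt (n G₁) r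
  ... | inj₁ u | inj₁ v | inj₁ w = cong glueˡ (P₁.consecutive u v w p<q q<r (glueˡ-injective p~r))
  ... | inj₂ u | inj₂ v | inj₂ w =
    cong glueʳ (P₂.consecutive u v w (+-cancelˡ-< M _ _ p<q) (+-cancelˡ-< M _ _ q<r) (glueʳ-injective p~r))
  ... | inj₁ u | inj₁ v | inj₂ w =
    let u-top = proj₁ (glue-overlap-only p~r) in cong glueˡ (trans (final p<q u-top) (sym u-top))
  ... | inj₁ u | inj₂ v | inj₂ w =
    let u-top , w-bottom = glue-overlap-only p~r in begin
      glueʳ (P₂.cls v)  ≡⟨ cong glueʳ (initial (+-cancelˡ-< M _ _ q<r) w-bottom) ⟩
      glueʳ zero        ≡⟨ sym glue-overlap ⟩
      glueˡ (fromℕ a)   ≡⟨ cong glueˡ (sym u-top) ⟩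
      glueˡ (P₁.cls u)  ∎
    where open ≡-Reasoning
  ... | inj₂ u | inj₁ v | _      = ⊥-elim (<-asym p<q (pos₁<pos₂ v u))
  ... | inj₁ _ | inj₂ v | inj₁ w = ⊥-elim (<-asym q<r (pos₁<pos₂ w v))
  ... | inj₂ _ | inj₂ v | inj₁ w = ⊥-elim (<-asym q<r (pos₁<pos₂ w v))

  partition : PrecPartition (G₁ ∪ G₂) (a + suc b)
  partition = cls , pos , cls-surjective , pos-injective , consistent , consecutive

∪-partition : ∀ {G₁ G₂ k₁ k₂} → Fin (n G₁) → Fin (n G₂) →
              PrecPartition G₁ k₁ → PrecPartition G₂ k₂ →
              PrecPartition (G₁ ∪ G₂) (k₁ + k₂ ∸ 1)
∪-partition {k₁ = zero} u _ (cls , _) _ with cls u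
... | ()
∪-partition {k₁ = suc _} {k₂ = zero} _ v _ (cls , _) with cls v
... | ()
∪-partition {G₁} {G₂} {suc a} {suc b} u v pp₁ pp₂ =
  let pp₁′ , final = with-final-class G₁ u pp₁ (fromℕ a)
      pp₂′ , initial = with-initial-class G₂ v pp₂ zero
  in Gluing.partition pp₁′ final pp₂′ initial

↑ˡ≢↑ʳ : ∀ {m′} (i : Fin m) (j : Fin m′) → i ↑ˡ m′ ≢ m ↑ʳ j
↑ˡ≢↑ʳ {m} {m′} i j eq
  with trans (sym (splitAt-↑ˡ m i m′)) (trans (cong (splitAt m) eq) (splitAt-↑ʳ m m′ j))
... | ()

module _ (G₁ G₂ : Graph) where

  ∪-edge-↑ˡ : ∀ {u v} → E G₁ u v ⇔ E (G₁ ∪ G₂) (u ↑ˡ n G₂) (v ↑ˡ n G₂)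
  ∪-edge-↑ˡ {u} {v} rewrite splitAt-↑ˡ (n G₁) u (n G₂) | splitAt-↑ˡ (n G₁) v (n G₂) = mk⇔ id id

  ∪-edge-↑ʳ : ∀ {u v} → E G₂ u v ⇔ E (G₁ ∪ G₂) (n G₁ ↑ʳ u) (n G₁ ↑ʳ v)
  ∪-edge-↑ʳ {u} {v} rewrite splitAt-↑ʳ (n G₁) (n G₂) u | splitAt-↑ʳ (n G₁) (n G₂) v = mk⇔ id id

  ∪-no-edge : ∀ {u v} → ¬ E (G₁ ∪ G₂) (u ↑ˡ n G₂) (n G₁ ↑ʳ v)
  ∪-no-edge {u} {v} rewrite splitAt-↑ˡ (n G₁) u (n G₂) | splitAt-↑ʳ (n G₁) (n G₂) v = λ ()

module Restriction (H : Graph) (pp : PrecPartition H k) (G : Graph)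
  (ι : Fin (n G) → Fin (n H)) (ι-injective : Injective _≡_ _≡_ ι)
  (ι-edge : ∀ {a b} → E G a b ⇔ E H (ι a) (ι b))
  {m′ : ℕ} (ι′ : Fin m′ → Fin (n H)) (ι′≢ι : ∀ {a b} → ι′ b ≢ ι a)
  (no-edge : ∀ {a b} → ¬ E H (ι a) (ι′ b))
  where

  open Fields H pp

  P : Fin (n G) → ℕ
  P = pos ∘ ι

  C : Fin (n G) → Fin k
  C = cls ∘ ι

  P-injective : Injective _≡_ _≡_ P
  P-injective = ι-injective ∘ pos-injective

  Last : Fin (n G) → Set
  Last x = ∀ u → P u ≤ P x

  last-unique : ∀ {x y} → Last x → Last y → x ≡ y
  last-unique {x} {y} last-x last-y = P-injective (≤-antisym (last-y x) (last-x y))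

  Bad : Fin (n G) → Set
  Bad a = (∃ λ b → cls (ι′ b) ≡ C a × P a < pos (ι′ b)) × (∃ λ a′ → P a < P a′)

  Good : Fin (n G) → Set
  Good a = ¬ Bad a

  bad? : Decidable Bad
  bad? a = any? (λ b → (cls (ι′ b) ≟ C a) ×-dec (P a <? pos (ι′ b)))
    ×-dec any? (λ a′ → P a <? P a′)

  last-good : ∀ {x} → Last x → Good x
  last-good last (_ , a′ , x<a′) = <⇒≱ x<a′ (last a′)

  good-before-outside-last : ∀ {x b} → Good x → cls (ι′ b) ≡ C x → P x < pos (ι′ b) → Last x
  good-before-outside-last good-x b~x x<b u = ≮⇒≥ λ x<u → good-x ((_ , b~x , x<b) , u , x<u)

  GoodFrom : Fin (n G) → Fin (n G) → Set
  GoodFrom a u = P a ≤ P u × Good u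

  next-good-spec : ∀ a → ∃ λ u → GoodFrom a u × (∀ {v} → GoodFrom a v → P u ≤ P v)
  next-good-spec a =
    let x , last = maximum P a in
    least-satisfying P (λ u → (P a ≤? P u) ×-dec ¬? (bad? u)) (last a , last-good last)

  next-good : Fin (n G) → Fin (n G)
  next-good a = proj₁ (next-good-spec a)

  next-good-≥ : ∀ a → P a ≤ P (next-good a)
  next-good-≥ a = proj₁ (proj₁ (proj₂ (next-good-spec a)))

  next-good-good : ∀ a → Good (next-good a)
  next-good-good a = proj₂ (proj₁ (proj₂ (next-good-spec a)))

  next-good-least : ∀ a {v} → P a ≤ P v → Good v → P (next-good a) ≤ P v
  next-good-least a a≤v good-v = proj₂ (proj₂ (next-good-spec a)) (a≤v , good-v)

  next-good-fixed : ∀ {a} → Good a → next-good a ≡ a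
  next-good-fixed {a} good-a = P-injective (≤-antisym (next-good-least a ≤-refl good-a) (next-good-≥ a))

  next-good-> : ∀ {a} → Bad a → P a < P (next-good a)
  next-good-> {a} bad-a = ≤∧≢⇒< (next-good-≥ a)
    λ eq → next-good-good a (subst Bad (P-injective eq) bad-a)

  next-good-monotone : ∀ {a a′} → P a ≤ P a′ → P (next-good a) ≤ P (next-good a′)
  next-good-monotone {a} {a′} a≤a′ =
    next-good-least a (≤-trans a≤a′ (next-good-≥ a′)) (next-good-good a′)

  L : Fin (n G) → Fin k
  L = C ∘ next-good

  L-good : ∀ {a} → Good a → L a ≡ C a
  L-good good-a = cong C (next-good-fixed good-a)

  bad-absorbs : ∀ {p q r} → Bad p → P p < P q → P q < P r → E G p r → C q ≡ C p
  bad-absorbs {p} {q} {r} ((b , b~p , p<b) , _) p<q q<r e =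
    consecutive (ι p) (ι q) (ι′ b) p<q (<-trans q<r r<b) (sym b~p)
    where
      -- if b preceded r, consistency would give an edge between b and r
      r<b : P r < pos (ι′ b)
      r<b with <-cmp (P r) (pos (ι′ b))
      ... | tri< r<b _ _ = r<b
      ... | tri≈ _ r≡b _ = ⊥-elim (ι′≢ι (pos-injective (sym r≡b)))
      ... | tri> _ _ b<r = ⊥-elim (no-edge (Graph.sym H
              (consistent (ι p) (ι′ b) (ι r) p<b b<r (sym b~p) (Equivalence.to ι-edge e))))

  good-absorbs : ∀ {p q} → Good p → P p < P q → L p ≡ L q → C q ≡ C p
  good-absorbs {p} {q} good-p p<q Lp≡Lq with bad? q
  ... | no good-q = trans (sym (L-good good-q)) (trans (sym Lp≡Lq) (L-good good-p))
  ... | yes bad-q = consecutive (ι p) (ι q) (ι (next-good q)) p<q (next-good-> bad-q)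
                      (trans (sym (L-good good-p)) Lp≡Lq)

  L-consistent : Consistent G L P
  L-consistent p q r p<q q<r Lp≡Lq e =
    Equivalence.from ι-edge (consistent (ι p) (ι q) (ι r) p<q q<r (sym Cq≡Cp) (Equivalence.to ι-edge e))
    where
      Cq≡Cp : C q ≡ C p
      Cq≡Cp with bad? p
      ... | yes bad-p = bad-absorbs bad-p p<q q<r e
      ... | no good-p = good-absorbs good-p p<q Lp≡Lq

  L-consecutive : Consecutive G L P
  L-consecutive p q r p<q q<r Lp≡Lr
    with m≤n⇒m<n∨m≡n (next-good-monotone (<⇒≤ p<q)) | m≤n⇒m<n∨m≡n (next-good-monotone (<⇒≤ q<r))
  ... | inj₂ p′≡q′ | _          = cong C (P-injective (sym p′≡q′))
  ... | inj₁ _     | inj₂ q′≡r′ = trans (cong C (P-injective q′≡r′)) (sym Lp≡Lr)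
  ... | inj₁ p′<q′ | inj₁ q′<r′ =
    consecutive (ι (next-good p)) (ι (next-good q)) (ι (next-good r)) p′<q′ q′<r′ Lp≡Lr

  partition : PrecPartition G (count (used? L))
  partition = compress G P-injective L-consistent L-consecutive

module Splitting (G₁ G₂ : Graph) (pp : PrecPartition (G₁ ∪ G₂) k) where
  open Fields (G₁ ∪ G₂) pp

  ι₁ : Fin (n G₁) → Fin (n G₁ + n G₂)
  ι₁ u = u ↑ˡ n G₂

  ι₂ : Fin (n G₂) → Fin (n G₁ + n G₂)
  ι₂ v = n G₁ ↑ʳ v

  module R₁ = Restriction (G₁ ∪ G₂) pp G₁ ι₁ (↑ˡ-injective (n G₂) _ _) (∪-edge-↑ˡ G₁ G₂)
                ι₂ (λ eq → ↑ˡ≢↑ʳ _ _ (sym eq)) (∪-no-edge G₁ G₂)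
  module R₂ = Restriction (G₁ ∪ G₂) pp G₂ ι₂ (↑ʳ-injective (n G₁) _ _) (∪-edge-↑ʳ G₁ G₂)
                ι₁ (↑ˡ≢↑ʳ _ _) (∪-no-edge G₁ G₂ ∘ Graph.sym (G₁ ∪ G₂))

  shared-class-position : ∀ {x y} → R₁.Good x → R₂.Good y → R₁.C x ≡ R₂.C y →
                          (R₁.Last x × pos (ι₁ x) < pos (ι₂ y)) ⊎
                          (R₂.Last y × pos (ι₂ y) < pos (ι₁ x))
  shared-class-position {x} {y} good-x good-y x~y with <-cmp (pos (ι₁ x)) (pos (ι₂ y))
  ... | tri< x<y _ _ = inj₁ (R₁.good-before-outside-last good-x (sym x~y) x<y , x<y)
  ... | tri≈ _ x≡y _ = ⊥-elim (↑ˡ≢↑ʳ x y (pos-injective x≡y))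
  ... | tri> _ _ y<x = inj₂ (R₂.good-before-outside-last good-y x~y y<x , y<x)

  no-crossing : ∀ {x y x′ y′} → R₁.Last x → pos (ι₁ x) < pos (ι₂ y) →
                R₂.Last y′ → pos (ι₂ y′) < pos (ι₁ x′) → ⊥
  no-crossing {x} {y} {x′} {y′} last-x x<y last-y′ y′<x′ = <-irrefl refl (begin-strict
    pos (ι₁ x′) ≤⟨ last-x x′ ⟩
    pos (ι₁ x)  <⟨ x<y ⟩
    pos (ι₂ y)  ≤⟨ last-y′ y ⟩
    pos (ι₂ y′) <⟨ y′<x′ ⟩
    pos (ι₁ x′) ∎)
    where open ≤-Reasoning

  shared-class-unique : ∀ {c d} → Used R₁.L c × Used R₂.L c → Used R₁.L d × Used R₂.L d → c ≡ d
  shared-class-unique ((a , refl) , (b , Lb≡c)) ((a′ , refl) , (b′ , Lb′≡d))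
    with shared-class-position (R₁.next-good-good a) (R₂.next-good-good b) (sym Lb≡c)
       | shared-class-position (R₁.next-good-good a′) (R₂.next-good-good b′) (sym Lb′≡d)
  ... | inj₁ (last-x , _) | inj₁ (last-x′ , _) = cong R₁.C (R₁.last-unique last-x last-x′)
  ... | inj₂ (last-y , _) | inj₂ (last-y′ , _) =
    trans (sym Lb≡c) (trans (cong R₂.C (R₂.last-unique last-y last-y′)) Lb′≡d)
  ... | inj₁ (last-x , x<y) | inj₂ (last-y′ , y′<x′) = ⊥-elim (no-crossing last-x x<y last-y′ y′<x′)
  ... | inj₂ (last-y , y<x) | inj₁ (last-x′ , x′<y′) = ⊥-elim (no-crossing last-x′ x′<y′ last-y y<x)

  class-count-bound : count (used? R₁.L) + count (used? R₂.L) ≤ suc k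
  class-count-bound = begin
    count (used? R₁.L) + count (used? R₂.L)   ≤⟨ count-inclusion-exclusion (used? R₁.L) (used? R₂.L) ⟩
    k + count (used? R₁.L ∩? used? R₂.L)      ≤⟨ +-monoʳ-≤ k (count≤1 _ shared-class-unique) ⟩
    k + 1                                     ≡⟨ +-comm k 1 ⟩
    suc k                                     ∎
    where open ≤-Reasoning

∪-partition-split : ∀ G₁ G₂ → PrecPartition (G₁ ∪ G₂) k →
                    ∃₂ λ k₁ k₂ → PrecPartition G₁ k₁ × PrecPartition G₂ k₂ × k₁ + k₂ ≤ suc k
∪-partition-split G₁ G₂ pp = _ , _ , R₁.partition , R₂.partition , class-count-bound
  where open Splitting G₁ G₂ pp

theorem25 : (G₁ G₂ : Graph) → 0 < n G₁ → 0 < n G₂ → (k₁ k₂ : ℕ) →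
    ThinPrec G₁ k₁ → ThinPrec G₂ k₂ → ThinPrec (G₁ ∪ G₂) (k₁ + k₂ ∸ 1)
theorem25 G₁ G₂ 0<n₁ 0<n₂ k₁ k₂ (pp₁ , minimal₁) (pp₂ , minimal₂) =
  ∪-partition (fromℕ< 0<n₁) (fromℕ< 0<n₂) pp₁ pp₂ , minimal
  where
    minimal : ∀ j → PrecPartition (G₁ ∪ G₂) j → k₁ + k₂ ∸ 1 ≤ j
    minimal j pp =
      let j₁ , j₂ , pp₁′ , pp₂′ , j₁+j₂≤1+j = ∪-partition-split G₁ G₂ pp
      in ∸-monoˡ-≤ 1 (≤-trans (+-mono-≤ (minimal₁ j₁ pp₁′) (minimal₂ j₂ pp₂′)) j₁+j₂≤1+j)
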